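{- For each $n\in\mathbb{N}$, the curve $C_n$ is an initial segment of the part $(X_k)_{k\ge1}$ of $C$ starting at $0$; that is, if $C_n=(S_1,\dots,S_{2^n})$ then $S_i=X_i$ for $1\le i\le 2^n$.
   Context: Let $e=(1,0)$, $f=(0,1)$, $-\mathbb{N}=\{0,-1,-2,\dots\}$. For $a=(a_i)_{i\in-\mathbb{N}}\in\{0,1\}^{ -\mathbb{N}}$ define $a+1=(b_i)$: if all $a_i=1$ then all $b_i=0$; otherwise, with $i$ the largest index such that $a_i=0$, $b_j=a_j$ for $j<i$, $b_i=1$, $b_j=0$ for $j>i$. Each integer $k$ is identified with $0+k$ ($0$ the all-zero sequence; for $k\ge0$ this is the binary expansion with $a_0$ the least significant digit). $P(a)=a_0$; if $a=b+1$, $Q(a)$ is the number of $i$ with $(b_{i-2},b_{i-1},b_i)=(1,1,0)$ and $(a_{i-2},a_{i-1},a_i)\neq(1,1,0)$, and $R(a)$ the number of $i$ with $(b_{i-2},b_{i-1},b_i)\neq(1,1,0)$ and $(a_{i-2},a_{i-1},a_i)=(1,1,0)$. Curves are sequences of consecutive oriented unit segments $X_k=[p_{k-1},p_k]$; turning right (resp. left) from $X_k$ to $X_{k+1}$ means $p_{k+1}-p_k$ is $p_k-p_{k-1}$ rotated by $-\pi/2$ (resp. $+\pi/2$). Let $C=(X_k)_{k\in\mathbb{Z}}$ be the curve with $X_0=[-f,0]$, $X_1=[0,e]$ such that for each $k\in\mathbb{Z}\setminus\{0\}$, $X_{k+1}$ is obtained from $X_k$ by turning right if $P(k)+Q(k)+R(k)$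 is even and left otherwise. Let $\Omega$ be the free monoid on $u,\bar u,v,\bar v,w,\bar w$ and $\varphi$ its endomorphism with $\varphi(u)=uv$, $\varphi(\bar u)=\bar u\bar v$, $\varphi(v)=uw$, $\varphi(\bar v)=\bar u\bar w$, $\varphi(w)=\bar u w$, $\varphi(\bar w)=u\bar w$. For $n\in\mathbb{N}$, write $\varphi^n(u)=x_1\cdots x_{2^n}$ with letters $x_i$; $C_n=(S_1,\dots,S_{2^n})$ is the curve of consecutive oriented unit segments starting at $0$ in which $S_i$ is a translate of the vector $e$, $-e$, $f$, $-f$, $f$, $-f$ according as $x_i=u,\bar u,v,\bar v,w,\bar w$. -}

module Defs where

open import Data.Nat using (ℕ; zero; suc; _+_; _∸_; _%_; _/_; _≡ᵇ_)
open import Data.Integer as ℤ using (ℤ; +_; -_)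
open import Data.Bool using (Bool; true; false; if_then_else_; _∧_; not)
open import Data.Product using (_×_; _,_)
open import Data.List using (List; []; _∷_; concatMap; upTo; map)
open import Data.Nat.ListAction using (sum)
open import Data.Maybe using (Maybe; just; nothing)

V : Set
V = ℤ × ℤ

_⊕_ : V → V → V
(a , b) ⊕ (c , d) = (a ℤ.+ c , b ℤ.+ d)

0v e f : V
0v = (+ 0 , + 0)
e  = (+ 1 , + 0)
f  = (+ 0 , + 1)

rotR rotL : V → V
rotR (x , y) = (y , - x)
rotL (x , y) = (- y , x)

-- an oriented unit segment [p, q] is represented by its endpoints (p , q)
Seg : Set
Seg = V × V

-- Binary digits: for k ∈ ℕ, digit j of k is the paper's a_{-j}
-- (a_0 is the least significant digit).

bit : ℕ → ℕ → ℕ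
bit k zero    = k % 2
bit k (suc j) = bit (k / 2) j

-- (a_{i-2}, a_{i-1}, a_i) = (1,1,0) for i = -j
pat : ℕ → ℕ → Bool
pat k j = (bit k (suc (suc j)) ≡ᵇ 1) ∧ (bit k (suc j) ≡ᵇ 1) ∧ (bit k j ≡ᵇ 0)

count : (ℕ → Bool) → ℕ → ℕ
count p n = sum (map (λ j → if p j then 1 else 0) (upTo n))

P : ℕ → ℕ
P k = bit k 0

-- For k ≥ 1, k = (k-1) + 1.  Only positions j < k can carry the pattern
-- in k or k-1 (a 1 in position j+1 forces the number to be ≥ 2^(j+1) > j),
-- so counting over j < k counts all indices i ∈ -ℕ.
Q : ℕ → ℕ
Q k = count (λ j → pat (k ∸ 1) j ∧ not (pat k j)) k

R : ℕ → ℕ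
R k = count (λ j → not (pat (k ∸ 1) j) ∧ pat k j) k

step : ℕ → V → V
step k d = if ((P k + Q k + R k) % 2) ≡ᵇ 0 then rotR d else rotL d

-- The curve C (nonnegative part).  dirX k = p_k - p_{k-1}, the direction of X_k.

dirX : ℕ → V
dirX zero          = f
dirX (suc zero)    = e
dirX (suc (suc m)) = step (suc m) (dirX (suc m))

pX : ℕ → V
pX zero    = 0v
pX (suc k) = pX k ⊕ dirX (suc k)

X : ℕ → Seg
X zero    = ((+ 0 , - (+ 1)) , 0v)
X (suc m) = (pX m , pX (suc m))

data Letter : Set where
  u ū v v̄ w w̄ : Letter

φ₁ : Letter → List Letter
φ₁ u = u ∷ v ∷ []
φ₁ ū = ū ∷ v̄ ∷ []
φ₁ v = u ∷ w ∷ []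
φ₁ v̄ = ū ∷ w̄ ∷ []
φ₁ w = ū ∷ w ∷ []
φ₁ w̄ = u ∷ w̄ ∷ []

φ : List Letter → List Letter
φ = concatMap φ₁

φ^_[u] : ℕ → List Letter
φ^ zero  [u] = u ∷ []
φ^ suc n [u] = φ (φ^ n [u])

vec : Letter → V
vec u = e
vec ū = (- (+ 1) , + 0)
vec v = f
vec v̄ = (+ 0 , - (+ 1))
vec w = f
vec w̄ = (+ 0 , - (+ 1))

segsFrom : V → List Letter → List Seg
segsFrom p []       = []
segsFrom p (x ∷ xs) = (p , p ⊕ vec x) ∷ segsFrom (p ⊕ vec x) xs

Cn : ℕ → List Seg
Cn n = segsFrom 0v (φ^ n [u])

-- 1-based indexing: S A i = just S_i if 1 ≤ i ≤ length, nothing otherwise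
S : {A : Set} → List A → ℕ → Maybe A
S []       _             = nothing
S (x ∷ xs) zero          = nothing
S (x ∷ xs) (suc zero)    = just x
S (x ∷ xs) (suc (suc i)) = S xs (suc i)

-- The k-th letter of φⁿ(u) (counting from 0) is determined by three features of k: whether k is
-- odd (a vertical rather than horizontal step), whether ⌊k/2⌋ is odd (w rather than v), and the
-- parity of the number of occurrences of 110 in the binary expansion of k (barred or not); this
-- description is stable under φ because φ sends the letter at k to the letters at 2k and 2k+1.
-- Consecutive letters then always change axis, and the direction of the turn between them is
-- governed by the parities of k and of the two pattern counts, which is exactly P + Q + R mod 2,
-- since Q + R ≡ (#110 in k) + (#110 in k+1) (mod 2).
module Submission where

open import Defs
open import Data.Nat using (ℕ; _≤_; _<_; _^_; zero; suc; _+_; _*_; _%_; _/_; _≡ᵇ_; z≤n; s≤s; s≤s⁻¹)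
open import Data.Maybe using (just)
open import Relation.Binary.PropositionalEquality using (_≡_; refl; sym; trans; cong; cong₂; module ≡-Reasoning)

open import Algebra using (CommutativeRing)
open import Data.Bool using (Bool; true; false; if_then_else_; _∧_; not; _xor_)
open import Data.Bool.Properties
  using (not-involutive; not-distribˡ-xor; xor-assoc; xor-identityʳ; ∧-identityʳ; ∧-zeroʳ; xor-∧-commutativeRing)
open import Data.List using ([]; _∷_; [_]; _++_; _∷ʳ_; map; applyUpTo)
open import Data.List.Properties using (applyUpTo-∷ʳ; concatMap-++; ∷ʳ-++)
open import Data.Nat.DivMod using (m/n≡1+[m∸n]/n; [m+n]%n≡m%n; m/n<m)
open import Data.Nat.ListAction using (sum)
open import Data.Nat.Properties using (+-comm; +-suc; n≤1+n; <-≤-trans)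
open import Data.Product using (_,_)
open import Function using (_∘_)

open import Algebra.Properties.CommutativeSemigroup
  (CommutativeRing.+-commutativeSemigroup xor-∧-commutativeRing) using (interchange)

open ≡-Reasoning

[2+n]%2≡n%2 : ∀ n → suc (suc n) % 2 ≡ n % 2
[2+n]%2≡n%2 n = trans (cong (_% 2) (+-comm 2 n)) ([m+n]%n≡m%n n 2)

[2+n]/2≡1+n/2 : ∀ n → suc (suc n) / 2 ≡ suc (n / 2)
[2+n]/2≡1+n/2 n = m/n≡1+[m∸n]/n {suc (suc n)} (s≤s (s≤s z≤n))

double : ℕ → ℕ
double zero    = zero
double (suc m) = suc (suc (double m))

double≡2* : ∀ m → double m ≡ 2 * m
double≡2* zero    = refl
double≡2* (suc m) = cong suc (trans (cong suc (double≡2* m)) (sym (+-suc m (m + 0))))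

double[m]/2≡m : ∀ m → double m / 2 ≡ m
double[m]/2≡m zero    = refl
double[m]/2≡m (suc m) = trans ([2+n]/2≡1+n/2 (double m)) (cong suc (double[m]/2≡m m))

[1+double[m]]/2≡m : ∀ m → suc (double m) / 2 ≡ m
[1+double[m]]/2≡m zero    = refl
[1+double[m]]/2≡m (suc m) = trans ([2+n]/2≡1+n/2 (suc (double m))) (cong suc ([1+double[m]]/2≡m m))

isOdd : ℕ → Bool
isOdd zero    = false
isOdd (suc n) = not (isOdd n)

isOdd-+ : ∀ m n → isOdd (m + n) ≡ isOdd m xor isOdd n
isOdd-+ zero    n = refl
isOdd-+ (suc m) n = trans (cong not (isOdd-+ m n)) (not-distribˡ-xor (isOdd m) (isOdd n))

isOdd-double : ∀ m → isOdd (double m) ≡ false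
isOdd-double zero    = refl
isOdd-double (suc m) = trans (not-involutive _) (isOdd-double m)

isOdd[n%2]≡isOdd[n] : ∀ n → isOdd (n % 2) ≡ isOdd n
isOdd[n%2]≡isOdd[n] zero          = refl
isOdd[n%2]≡isOdd[n] (suc zero)    = refl
isOdd[n%2]≡isOdd[n] (suc (suc n)) =
  trans (cong isOdd ([2+n]%2≡n%2 n)) (trans (isOdd[n%2]≡isOdd[n] n) (sym (not-involutive _)))

[n%2≡ᵇ0]≡not[isOdd[n]] : ∀ n → (n % 2 ≡ᵇ 0) ≡ not (isOdd n)
[n%2≡ᵇ0]≡not[isOdd[n]] zero          = refl
[n%2≡ᵇ0]≡not[isOdd[n]] (suc zero)    = refl
[n%2≡ᵇ0]≡not[isOdd[n]] (suc (suc n)) =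
  trans (cong (_≡ᵇ 0) ([2+n]%2≡n%2 n)) (trans ([n%2≡ᵇ0]≡not[isOdd[n]] n) (sym (not-involutive _)))

[n%2≡ᵇ1]≡isOdd[n] : ∀ n → (n % 2 ≡ᵇ 1) ≡ isOdd n
[n%2≡ᵇ1]≡isOdd[n] zero          = refl
[n%2≡ᵇ1]≡isOdd[n] (suc zero)    = refl
[n%2≡ᵇ1]≡isOdd[n] (suc (suc n)) =
  trans (cong (_≡ᵇ 1) ([2+n]%2≡n%2 n)) (trans ([n%2≡ᵇ1]≡isOdd[n] n) (sym (not-involutive _)))

xorUpTo : (ℕ → Bool) → ℕ → Bool
xorUpTo p zero    = false
xorUpTo p (suc n) = p 0 xor xorUpTo (p ∘ suc) n

isOdd-indicator : ∀ b → isOdd (if b then 1 else 0) ≡ b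
isOdd-indicator false = refl
isOdd-indicator true  = refl

isOdd-sum-indicators : ∀ (p : ℕ → Bool) g n →
  isOdd (sum (map (λ j → if p j then 1 else 0) (applyUpTo g n))) ≡ xorUpTo (p ∘ g) n
isOdd-sum-indicators p g zero    = refl
isOdd-sum-indicators p g (suc n) =
  trans (isOdd-+ (if p (g 0) then 1 else 0) _)
        (cong₂ _xor_ (isOdd-indicator (p (g 0))) (isOdd-sum-indicators p (g ∘ suc) n))

isOdd-count : ∀ p n → isOdd (count p n) ≡ xorUpTo p n
isOdd-count p = isOdd-sum-indicators p (λ j → j)

xorUpTo-cong : ∀ {p q} → (∀ j → p j ≡ q j) → ∀ n → xorUpTo p n ≡ xorUpTo q n
xorUpTo-cong p≗q zero    = refl
xorUpTo-cong p≗q (suc n) = cong₂ _xor_ (p≗q 0) (xorUpTo-cong (p≗q ∘ suc) n)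

xorUpTo-xor : ∀ p q n → xorUpTo (λ j → p j xor q j) n ≡ xorUpTo p n xor xorUpTo q n
xorUpTo-xor p q zero    = refl
xorUpTo-xor p q (suc n) =
  trans (cong ((p 0 xor q 0) xor_) (xorUpTo-xor (p ∘ suc) (q ∘ suc) n))
        (interchange (p 0) (q 0) (xorUpTo (p ∘ suc) n) (xorUpTo (q ∘ suc) n))

xorUpTo-stable : ∀ p {B B′} → B ≤ B′ → (∀ j → B ≤ j → p j ≡ false) → xorUpTo p B′ ≡ xorUpTo p B
xorUpTo-stable p {B′ = zero}   z≤n vanish = refl
xorUpTo-stable p {B′ = suc B′} z≤n vanish =
  cong₂ _xor_ (vanish 0 z≤n) (xorUpTo-stable (p ∘ suc) {B′ = B′} z≤n (λ j _ → vanish (suc j) z≤n))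
xorUpTo-stable p (s≤s B≤B′) vanish =
  cong (p 0 xor_) (xorUpTo-stable (p ∘ suc) B≤B′ (λ j B≤j → vanish (suc j) (s≤s B≤j)))

∧-not-xor : ∀ a b → (a ∧ not b) xor (not a ∧ b) ≡ a xor b
∧-not-xor true  b = xor-identityʳ (not b)
∧-not-xor false b = refl

pat-zero : ∀ k → pat k 0 ≡ isOdd (k / 2 / 2) ∧ isOdd (k / 2) ∧ not (isOdd k)
pat-zero k rewrite [n%2≡ᵇ1]≡isOdd[n] (k / 2 / 2) | [n%2≡ᵇ1]≡isOdd[n] (k / 2) | [n%2≡ᵇ0]≡not[isOdd[n]] k = refl

-- pat k (suc j) is pat (k / 2) j by definition of bit.
pat-vanishes : ∀ {k} j → k ≤ j → pat k j ≡ false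
pat-vanishes zero    z≤n       = refl
pat-vanishes (suc j) z≤n       = pat-vanishes j z≤n
pat-vanishes (suc j) (s≤s k≤j) = pat-vanishes j (s≤s⁻¹ (<-≤-trans (m/n<m _ 2 (s≤s (s≤s z≤n))) (s≤s k≤j)))

patParity : ℕ → Bool
patParity k = xorUpTo (pat k) k

patParity-upTo : ∀ k {B} → k ≤ B → xorUpTo (pat k) B ≡ patParity k
patParity-upTo k k≤B = xorUpTo-stable (pat k) k≤B pat-vanishes

patParity-half : ∀ k → patParity k ≡ pat k 0 xor patParity (k / 2)
patParity-half zero    = refl
patParity-half (suc k) =
  cong (pat (suc k) 0 xor_) (patParity-upTo (suc k / 2) (s≤s⁻¹ (m/n<m (suc k) 2 (s≤s (s≤s z≤n)))))

pat-double : ∀ m → pat (double m) 0 ≡ isOdd (m / 2) ∧ isOdd m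
pat-double m = begin
  pat (double m) 0
    ≡⟨ pat-zero (double m) ⟩
  isOdd (double m / 2 / 2) ∧ isOdd (double m / 2) ∧ not (isOdd (double m))
    ≡⟨ cong₂ (λ n b → isOdd (n / 2) ∧ isOdd n ∧ not b) (double[m]/2≡m m) (isOdd-double m) ⟩
  isOdd (m / 2) ∧ isOdd m ∧ true
    ≡⟨ cong (isOdd (m / 2) ∧_) (∧-identityʳ (isOdd m)) ⟩
  isOdd (m / 2) ∧ isOdd m ∎

pat-suc-double : ∀ m → pat (suc (double m)) 0 ≡ false
pat-suc-double m = begin
  pat (suc (double m)) 0               ≡⟨ pat-zero (suc (double m)) ⟩
  x ∧ y ∧ not (not (isOdd (double m))) ≡⟨ cong (λ b → x ∧ y ∧ not (not b)) (isOdd-double m) ⟩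
  x ∧ y ∧ false                        ≡⟨ trans (cong (x ∧_) (∧-zeroʳ y)) (∧-zeroʳ x) ⟩
  false                                ∎
  where
  x y : Bool
  x = isOdd (suc (double m) / 2 / 2)
  y = isOdd (suc (double m) / 2)

patParity-double : ∀ m → patParity (double m) ≡ (isOdd (m / 2) ∧ isOdd m) xor patParity m
patParity-double m =
  trans (patParity-half (double m)) (cong₂ _xor_ (pat-double m) (cong patParity (double[m]/2≡m m)))

patParity-suc-double : ∀ m → patParity (suc (double m)) ≡ patParity m
patParity-suc-double m =
  trans (patParity-half (suc (double m))) (cong₂ _xor_ (pat-suc-double m) (cong patParity ([1+double[m]]/2≡m m)))

Q+R-parity : ∀ k → isOdd (Q (suc k)) xor isOdd (R (suc k)) ≡ patParity k xor patParity (suc k)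
Q+R-parity k = begin
  isOdd (Q (suc k)) xor isOdd (R (suc k))
    ≡⟨ cong₂ _xor_ (isOdd-count lost (suc k)) (isOdd-count gained (suc k)) ⟩
  xorUpTo lost (suc k) xor xorUpTo gained (suc k)
    ≡⟨ sym (xorUpTo-xor lost gained (suc k)) ⟩
  xorUpTo (λ j → lost j xor gained j) (suc k)
    ≡⟨ xorUpTo-cong (λ j → ∧-not-xor (pat k j) (pat (suc k) j)) (suc k) ⟩
  xorUpTo (λ j → pat k j xor pat (suc k) j) (suc k)
    ≡⟨ xorUpTo-xor (pat k) (pat (suc k)) (suc k) ⟩
  xorUpTo (pat k) (suc k) xor patParity (suc k)
    ≡⟨ cong (_xor patParity (suc k)) (patParity-upTo k (n≤1+n k)) ⟩
  patParity k xor patParity (suc k) ∎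
  where
  lost gained : ℕ → Bool
  lost   j = pat k j ∧ not (pat (suc k) j)
  gained j = not (pat k j) ∧ pat (suc k) j

turn-parity : ∀ k → isOdd (P (suc k) + Q (suc k) + R (suc k)) ≡ isOdd (suc k) xor (patParity k xor patParity (suc k))
turn-parity k = begin
  isOdd (P k′ + Q k′ + R k′)                        ≡⟨ isOdd-+ (P k′ + Q k′) (R k′) ⟩
  isOdd (P k′ + Q k′) xor isOdd (R k′)              ≡⟨ cong (_xor isOdd (R k′)) (isOdd-+ (P k′) (Q k′)) ⟩
  (isOdd (P k′) xor isOdd (Q k′)) xor isOdd (R k′)  ≡⟨ xor-assoc (isOdd (P k′)) _ _ ⟩
  isOdd (P k′) xor (isOdd (Q k′) xor isOdd (R k′))  ≡⟨ cong₂ _xor_ (isOdd[n%2]≡isOdd[n] k′) (Q+R-parity k) ⟩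
  isOdd k′ xor (patParity k xor patParity k′)       ∎
  where
  k′ : ℕ
  k′ = suc k

-- Arguments: barred, vertical, and w rather than v (irrelevant for the horizontal letters u, ū).
mkLetter : Bool → Bool → Bool → Letter
mkLetter false false _     = u
mkLetter true  false _     = ū
mkLetter false true  false = v
mkLetter true  true  false = v̄
mkLetter false true  true  = w
mkLetter true  true  true  = w̄

φ₁-mkLetter : ∀ s b c → φ₁ (mkLetter s b c) ≡ mkLetter ((c ∧ b) xor s) false b ∷ mkLetter s true b ∷ []
φ₁-mkLetter false false false = refl
φ₁-mkLetter false false true  = refl
φ₁-mkLetter true  false false = refl
φ₁-mkLetter true  false true  = refl
φ₁-mkLetter false true  false = refl
φ₁-mkLetter false true  true  = refl
φ₁-mkLetter true  true  false = refl
φ₁-mkLetter true  true  true  = refl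

letter : ℕ → Letter
letter k = mkLetter (patParity k) (isOdd k) (isOdd (k / 2))

φ₁-letter : ∀ m → φ₁ (letter m) ≡ letter (double m) ∷ letter (suc (double m)) ∷ []
φ₁-letter m = begin
  φ₁ (letter m)
    ≡⟨ φ₁-mkLetter (patParity m) (isOdd m) (isOdd (m / 2)) ⟩
  mkLetter ((isOdd (m / 2) ∧ isOdd m) xor patParity m) false (isOdd m) ∷ mkLetter (patParity m) true (isOdd m) ∷ []
    ≡⟨ cong₂ (λ x y → x ∷ y ∷ []) (sym even) (sym odd) ⟩
  letter (double m) ∷ letter (suc (double m)) ∷ [] ∎
  where
  even : letter (double m) ≡ mkLetter ((isOdd (m / 2) ∧ isOdd m) xor patParity m) false (isOdd m)
  even rewrite patParity-double m | isOdd-double m | double[m]/2≡m m = refl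
  odd : letter (suc (double m)) ≡ mkLetter (patParity m) true (isOdd m)
  odd rewrite patParity-suc-double m | isOdd-double m | [1+double[m]]/2≡m m = refl

φ-applyUpTo : ∀ (f : ℕ → Letter) → (∀ m → φ₁ (f m) ≡ f (double m) ∷ f (suc (double m)) ∷ []) →
              ∀ M → φ (applyUpTo f M) ≡ applyUpTo f (double M)
φ-applyUpTo f split zero    = refl
φ-applyUpTo f split (suc M) = begin
  φ (applyUpTo f (suc M))                              ≡⟨ cong φ (applyUpTo-∷ʳ f M) ⟨
  φ (applyUpTo f M ∷ʳ f M)                             ≡⟨ concatMap-++ φ₁ (applyUpTo f M) [ f M ] ⟩
  φ (applyUpTo f M) ++ φ₁ (f M) ++ []                  ≡⟨ cong₂ (λ xs ys → xs ++ ys ++ []) (φ-applyUpTo f split M) (split M) ⟩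
  applyUpTo f (double M) ++ f 2M ∷ f (suc 2M) ∷ []     ≡⟨ ∷ʳ-++ (applyUpTo f 2M) (f 2M) [ f (suc 2M) ] ⟨
  applyUpTo f 2M ∷ʳ f 2M ++ [ f (suc 2M) ]             ≡⟨ cong (_∷ʳ f (suc 2M)) (applyUpTo-∷ʳ f 2M) ⟩
  applyUpTo f (suc 2M) ∷ʳ f (suc 2M)                   ≡⟨ applyUpTo-∷ʳ f (suc 2M) ⟩
  applyUpTo f (double (suc M))                         ∎
  where
  2M : ℕ
  2M = double M

φ^[u]≡applyUpTo : ∀ (f : ℕ → Letter) → f 0 ≡ u → (∀ m → φ₁ (f m) ≡ f (double m) ∷ f (suc (double m)) ∷ []) →
                  ∀ n → φ^ n [u] ≡ applyUpTo f (2 ^ n)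
φ^[u]≡applyUpTo f f0≡u split zero    = cong [_] (sym f0≡u)
φ^[u]≡applyUpTo f f0≡u split (suc n) = begin
  φ (φ^ n [u])                 ≡⟨ cong φ (φ^[u]≡applyUpTo f f0≡u split n) ⟩
  φ (applyUpTo f (2 ^ n))      ≡⟨ φ-applyUpTo f split (2 ^ n) ⟩
  applyUpTo f (double (2 ^ n)) ≡⟨ cong (applyUpTo f) (double≡2* (2 ^ n)) ⟩
  applyUpTo f (2 ^ suc n)      ∎

turn-mkLetter : ∀ s t b c c′ →
  (if not (not b xor (s xor t)) then rotR (vec (mkLetter s b c)) else rotL (vec (mkLetter s b c)))
    ≡ vec (mkLetter t (not b) c′)
turn-mkLetter false false false c false = refl
turn-mkLetter false false false c true  = refl
turn-mkLetter false true  false c false = refl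
turn-mkLetter false true  false c true  = refl
turn-mkLetter true  false false c false = refl
turn-mkLetter true  false false c true  = refl
turn-mkLetter true  true  false c false = refl
turn-mkLetter true  true  false c true  = refl
turn-mkLetter false false true false c′ = refl
turn-mkLetter false false true true  c′ = refl
turn-mkLetter false true  true false c′ = refl
turn-mkLetter false true  true true  c′ = refl
turn-mkLetter true  false true false c′ = refl
turn-mkLetter true  false true true  c′ = refl
turn-mkLetter true  true  true false c′ = refl
turn-mkLetter true  true  true true  c′ = refl

vec-letter : ∀ k → vec (letter k) ≡ dirX (suc k)
vec-letter zero    = refl
vec-letter (suc k) = sym (begin
  dirX (suc (suc k))
    ≡⟨ cong (step (suc k)) (sym (vec-letter k)) ⟩
  step (suc k) (vec (letter k))
    ≡⟨ cong (λ b → if b then rotR (vec (letter k)) else rotL (vec (letter k))) turnCondition ⟩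
  (if not (not (isOdd k) xor (patParity k xor patParity (suc k))) then rotR (vec (letter k)) else rotL (vec (letter k)))
    ≡⟨ turn-mkLetter (patParity k) (patParity (suc k)) (isOdd k) (isOdd (k / 2)) (isOdd (suc k / 2)) ⟩
  vec (letter (suc k)) ∎)
  where
  turnCondition : ((P (suc k) + Q (suc k) + R (suc k)) % 2 ≡ᵇ 0) ≡ not (not (isOdd k) xor (patParity k xor patParity (suc k)))
  turnCondition = trans ([n%2≡ᵇ0]≡not[isOdd[n]] (P (suc k) + Q (suc k) + R (suc k))) (cong not (turn-parity k))

segsFrom-path : ∀ (q : ℕ → V) (f : ℕ → Letter) → (∀ j → q (suc j) ≡ q j ⊕ vec (f j)) →
                ∀ {M} i → i < M → S (segsFrom (q 0) (applyUpTo f M)) (suc i) ≡ just (q i , q (suc i))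
segsFrom-path q f path zero    (s≤s _) = cong (λ p → just (q 0 , p)) (sym (path 0))
segsFrom-path q f path {suc M} (suc i) (s≤s i<M) = begin
  S (segsFrom (q 0 ⊕ vec (f 0)) (applyUpTo (f ∘ suc) M)) (suc i)
    ≡⟨ cong (λ p → S (segsFrom p (applyUpTo (f ∘ suc) M)) (suc i)) (sym (path 0)) ⟩
  S (segsFrom (q 1) (applyUpTo (f ∘ suc) M)) (suc i)
    ≡⟨ segsFrom-path (q ∘ suc) (f ∘ suc) (path ∘ suc) i i<M ⟩
  just (q (suc i) , q (suc (suc i))) ∎

lemma3 : (n i : ℕ) → 1 ≤ i → i ≤ 2 ^ n → S (Cn n) i ≡ just (X i)
lemma3 n (suc i) _ i<2^n = begin
  S (segsFrom 0v (φ^ n [u])) (suc i)                    ≡⟨ cong (λ xs → S (segsFrom 0v xs) (suc i)) (φ^[u]≡applyUpTo letter refl φ₁-letter n) ⟩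
  S (segsFrom (pX 0) (applyUpTo letter (2 ^ n))) (suc i) ≡⟨ segsFrom-path pX letter (λ j → cong (pX j ⊕_) (sym (vec-letter j))) i i<2^n ⟩
  just (X (suc i))                                       ∎
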